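{- Let $n\ge 3$ and let $C$ be the oriented $n$-cycle quiver with vertices $f_1,\dots,f_n$ and arrows $f_i\to f_{i-1}$ for $1\le i\le n$, where $f_0=f_n$. Then the sequence $(f_n,f_{n-1},f_{n-2},\dots,f_1,\ f_3,f_4,\dots,f_n)$, read from left to right, is a maximal green sequence for $C$.
   Context: Mutation $\mu_k$ at a non-frozen vertex $k$ of an ice quiver: (1) for every 2-path $i\to k\to j$ add an arrow $i\to j$; (2) reverse all arrows incident to $k$; (3) delete 2-cycles created (cancelling opposite arrows pairwise) and any arrows between frozen vertices. The framed quiver $\hat C$ has vertices $\{f_i\}\sqcup\{f_i'\}$ (the $f_i'$ frozen) and arrows those of $C$ together with $f_i\to f_i'$. In a quiver obtained from $\hat C$ by mutations, a non-frozen vertex is green if it is the target of no arrow from a frozen vertex, and red if it is the source of no arrow to a frozen vertex. A green sequence is a sequence $(i_1,\dots,i_l)$ with $i_1$ green in $\hat C$ and each $i_k$ green in $\mu_{i_{k-1}}\circ\cdots\circ\mu_{i_1}(\hat C)$; it is maximal if all non-frozen vertices are red after applying all its mutations. -}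

module Defs where

open import Data.Nat using (ℕ; zero; suc; _+_; _*_; _∸_; _≡ᵇ_)
open import Data.Bool using (Bool; true; false; if_then_else_; _∧_; _∨_)
open import Data.Fin as Fin using (Fin; toℕ)
open import Data.Sum using (_⊎_; inj₁; inj₂)
open import Data.Sum.Properties using (≡-dec)
open import Data.Product using (_×_)
open import Data.Unit using (⊤)
open import Data.List using (List; []; _∷_; _++_; reverse; drop; allFin)
open import Relation.Nullary using (yes; no)
open import Relation.Binary.PropositionalEquality using (_≡_)

-- Vertices of the framed quiver Ĉ for a quiver on n vertices:
-- inj₁ i is the mutable vertex f_{i+1}, inj₂ i is the frozen vertex f'_{i+1}.
V : ℕ → Set
V n = Fin n ⊎ Fin n

frozen : ∀ {n} → V n → Bool
frozen (inj₁ _) = false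
frozen (inj₂ _) = true

_≟V_ : ∀ {n} (x y : V n) → Relation.Nullary.Dec (x ≡ y)
_≟V_ = ≡-dec Fin._≟_ Fin._≟_

-- An ice quiver on the vertex set V n, given by arrow multiplicities:
-- Q x y = number of arrows x → y.
IceQuiver : ℕ → Set
IceQuiver n = V n → V n → ℕ

-- Mutation μ_k at the non-frozen vertex k, performed literally in three steps.
-- (1) for every 2-path i → k → j add an arrow i → j
step1 : ∀ {n} → V n → IceQuiver n → IceQuiver n
step1 k Q i j with i ≟V k | j ≟V k
... | no _ | no _ = Q i j + Q i k * Q k j
... | _    | _    = Q i j

step2 : ∀ {n} → V n → IceQuiver n → IceQuiver n
step2 k Q i j with i ≟V k | j ≟V k
... | no _  | no _  = Q i j
... | _     | _     = Q j i

-- (3) cancel 2-cycles pairwise and delete arrows between frozen vertices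
step3 : ∀ {n} → IceQuiver n → IceQuiver n
step3 Q i j = if frozen i ∧ frozen j then 0 else Q i j ∸ Q j i

mutate : ∀ {n} → Fin n → IceQuiver n → IceQuiver n
mutate k Q = step3 (step2 (inj₁ k) (step1 (inj₁ k) Q))

mutateSeq : ∀ {n} → List (Fin n) → IceQuiver n → IceQuiver n
mutateSeq []       Q = Q
mutateSeq (k ∷ ks) Q = mutateSeq ks (mutate k Q)

Quiver : ℕ → Set
Quiver n = Fin n → Fin n → ℕ

framed : ∀ {n} → Quiver n → IceQuiver n
framed C (inj₁ i) (inj₁ j) = C i j
framed C (inj₁ i) (inj₂ j) with i Fin.≟ j
... | yes _ = 1
... | no _  = 0
framed C (inj₂ _) _ = 0

Green : ∀ {n} → IceQuiver n → Fin n → Set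
Green Q k = ∀ j → Q (inj₂ j) (inj₁ k) ≡ 0

Red : ∀ {n} → IceQuiver n → Fin n → Set
Red Q k = ∀ j → Q (inj₁ k) (inj₂ j) ≡ 0

GreenFrom : ∀ {n} → IceQuiver n → List (Fin n) → Set
GreenFrom Q []       = ⊤
GreenFrom Q (k ∷ ks) = Green Q k × GreenFrom (mutate k Q) ks

IsGreenSequence : ∀ {n} → Quiver n → List (Fin n) → Set
IsGreenSequence C s = GreenFrom (framed C) s

IsMaximalGreenSequence : ∀ {n} → Quiver n → List (Fin n) → Set
IsMaximalGreenSequence C s =
  IsGreenSequence C s × (∀ k → Red (mutateSeq s (framed C)) k)

-- Oriented n-cycle: index i : Fin n stands for f_{i+1}; arrows f_i → f_{i-1},
-- with f_0 = f_n, i.e. index i → index i-1, and index 0 → index n-1.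
cycleQuiver : (n : ℕ) → Quiver n
cycleQuiver n i j =
  if (toℕ i ≡ᵇ suc (toℕ j)) ∨ ((toℕ i ≡ᵇ 0) ∧ (toℕ j ≡ᵇ n ∸ 1)) then 1 else 0

-- The sequence (f_n, f_{n-1}, …, f_1, f_3, f_4, …, f_n) in 0-based indices:
-- (n-1, n-2, …, 0, 2, 3, …, n-1).
cycleSequence : (n : ℕ) → List (Fin n)
cycleSequence n = reverse (allFin n) ++ drop 2 (allFin n)

module Submission where

-- Every quiver met along the sequence has a uniform description: the number
-- of arrows x → y depends only on whether x, y are frozen, on the class of
-- their indices (0, 1, 2, 3 or ≥ 4), on the offset of each index relative to
-- the index mutated last, the "pivot" (≤ -2, -1, 0, +1 or ≥ +2), and on the
-- position of the two indices (equal, successor, predecessor, apart).  Such a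
-- description is an `AbstractQuiver`; five of them suffice: a descending stage
-- (the framed cycle and the quivers after mutating f_n, …, f_k for k ≥ 4), the
-- quivers after mutating f_3, f_2 and f_1, and an ascending stage (after
-- mutating f_3, …, f_k a second time).
--
-- By the mutation formula an entry of μ_k Q depends on eight entries of Q,
-- so mutating one stage into the next is a statement about finitely many
-- abstract configurations; `mutation-step` proves it for every n and every
-- pivot from a single Boolean check that is decided by evaluation.

open import Data.Nat using (ℕ; zero; suc; _+_; _*_; _∸_; _≡ᵇ_; _≤_; z≤n; s≤s)
open import Data.Nat.Properties using (+-identityʳ; +-suc; ≡ᵇ⇒≡; ≤-pred)
open import Data.Bool using (Bool; true; false; if_then_else_; _∧_; _∨_; not; T)
open import Data.Bool.ListAction using (all)
open import Data.Bool.Properties using (∧-zeroʳ; ∧-identityʳ; T-∧)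
open import Data.Sum using (inj₁; inj₂)
open import Data.Product using (_×_; _,_; proj₁; proj₂)
open import Data.Unit using (tt)
open import Data.Empty using (⊥-elim)
open import Data.List using (List; []; _∷_; _++_; reverse; drop; allFin; map; tabulate; upTo; downFrom; applyUpTo)
open import Data.List.Membership.Propositional using (_∈_)
open import Data.List.Relation.Unary.Any using (here; there)
import Data.List.Relation.Unary.All as All
open import Data.List.Relation.Unary.All.Properties using (all⁺)
open import Data.List.Properties using (reverse-map; reverse-upTo; map-tabulate; ∷-injectiveˡ; ∷-injectiveʳ)
open import Data.Fin as Fin using (Fin; toℕ)
open import Data.Fin.Properties using (toℕ<n; toℕ-injective)
open import Relation.Nullary using (¬_; Dec; yes; no; does)
open import Relation.Binary.PropositionalEquality
open import Function.Base using (id)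
open import Function.Bundles using (Equivalence)
open import Defs

isVertex : ∀ {n} → Fin n → V n → Bool
isVertex k x = does (x ≟V inj₁ k)

-- The entry (μ_k Q) x y as a function of the entries of Q it depends on:
-- qxy = Q x y, qyx = Q y x, qxk = Q x k, qky = Q k y, qyk = Q y k, qkx = Q k x.
mutationRule : (bothFrozen xIsK yIsK : Bool) (qxy qyx qxk qky qyk qkx : ℕ) → ℕ
mutationRule bothFrozen xIsK yIsK qxy qyx qxk qky qyk qkx =
  if bothFrozen then 0
  else if xIsK ∨ yIsK then qyx ∸ qxy
  else (qxy + qxk * qky) ∸ (qyx + qyk * qkx)

step1-formula : ∀ {n} (k : Fin n) (Q : IceQuiver n) x y →
  step1 (inj₁ k) Q x y
    ≡ (if isVertex k x ∨ isVertex k y then Q x y else Q x y + Q x (inj₁ k) * Q (inj₁ k) y)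
step1-formula k Q x y with x ≟V inj₁ k | y ≟V inj₁ k
... | yes _ | yes _ = refl
... | yes _ | no _  = refl
... | no _  | yes _ = refl
... | no _  | no _  = refl

step2-formula : ∀ {n} (k : Fin n) (Q : IceQuiver n) x y →
  step2 (inj₁ k) Q x y ≡ (if isVertex k x ∨ isVertex k y then Q y x else Q x y)
step2-formula k Q x y with x ≟V inj₁ k | y ≟V inj₁ k
... | yes _ | yes _ = refl
... | yes _ | no _  = refl
... | no _  | yes _ = refl
... | no _  | no _  = refl

mutate-formula : ∀ {n} (k : Fin n) (Q : IceQuiver n) x y →
  mutate k Q x y ≡ mutationRule (frozen x ∧ frozen y) (isVertex k x) (isVertex k y)
    (Q x y) (Q y x) (Q x (inj₁ k)) (Q (inj₁ k) y) (Q y (inj₁ k)) (Q (inj₁ k) x)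
mutate-formula k Q x y
  rewrite step2-formula k (step1 (inj₁ k) Q) x y | step2-formula k (step1 (inj₁ k) Q) y x
        | step1-formula k Q x y | step1-formula k Q y x
  with isVertex k x | isVertex k y
... | true  | true  = refl
... | true  | false = refl
... | false | true  = refl
... | false | false = refl

mutationRule-cong : ∀ {f kx kx' ky ky' q1 q1' q2 q2' q3 q3' q4 q4' q5 q5' q6 q6'} →
  kx ≡ kx' → ky ≡ ky' → q1 ≡ q1' → q2 ≡ q2' → q3 ≡ q3' → q4 ≡ q4' → q5 ≡ q5' → q6 ≡ q6' →
  mutationRule f kx ky q1 q2 q3 q4 q5 q6 ≡ mutationRule f kx' ky' q1' q2' q3' q4' q5' q6'
mutationRule-cong refl refl refl refl refl refl refl refl = refl

-- Pointwise equality of quivers (function extensionality is not available).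
_≈Q_ : ∀ {n} → IceQuiver n → IceQuiver n → Set
Q ≈Q Q' = ∀ x y → Q x y ≡ Q' x y

≈Q-sym : ∀ {n} {Q Q' : IceQuiver n} → Q ≈Q Q' → Q' ≈Q Q
≈Q-sym e x y = sym (e x y)

≈Q-trans : ∀ {n} {Q Q' Q'' : IceQuiver n} → Q ≈Q Q' → Q' ≈Q Q'' → Q ≈Q Q''
≈Q-trans e e' x y = trans (e x y) (e' x y)

mutate-cong : ∀ {n} (k : Fin n) {Q Q' : IceQuiver n} → Q ≈Q Q' → mutate k Q ≈Q mutate k Q'
mutate-cong k {Q} {Q'} e x y
  rewrite mutate-formula k Q x y | mutate-formula k Q' x y | e x y | e y x
        | e x (inj₁ k) | e (inj₁ k) y | e y (inj₁ k) | e (inj₁ k) x = refl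

mutateSeq-cong : ∀ {n} (s : List (Fin n)) {Q Q' : IceQuiver n} →
  Q ≈Q Q' → mutateSeq s Q ≈Q mutateSeq s Q'
mutateSeq-cong []      e = e
mutateSeq-cong (k ∷ s) e = mutateSeq-cong s (mutate-cong k e)

GreenFrom-cong : ∀ {n} (s : List (Fin n)) {Q Q' : IceQuiver n} →
  Q ≈Q Q' → GreenFrom Q s → GreenFrom Q' s
GreenFrom-cong []      e _        = tt
GreenFrom-cong (k ∷ s) e (g , gs) =
  (λ j → trans (sym (e _ _)) (g j)) , GreenFrom-cong s (mutate-cong k e) gs

GreenFrom-++ : ∀ {n} (xs ys : List (Fin n)) {Q : IceQuiver n} →
  GreenFrom Q xs → GreenFrom (mutateSeq xs Q) ys → GreenFrom Q (xs ++ ys)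
GreenFrom-++ []       ys g₁       g₂ = g₂
GreenFrom-++ (x ∷ xs) ys (g , g₁) g₂ = g , GreenFrom-++ xs ys g₁ g₂

mutateSeq-++ : ∀ {n} (xs ys : List (Fin n)) (Q : IceQuiver n) →
  mutateSeq (xs ++ ys) Q ≡ mutateSeq ys (mutateSeq xs Q)
mutateSeq-++ []       ys Q = refl
mutateSeq-++ (x ∷ xs) ys Q = mutateSeq-++ xs ys (mutate x Q)

GreenRun : ∀ {n} → IceQuiver n → List (Fin n) → IceQuiver n → Set
GreenRun Q s Q' = GreenFrom Q s × (mutateSeq s Q ≈Q Q')

run-nil : ∀ {n} {Q Q' : IceQuiver n} → Q ≈Q Q' → GreenRun Q [] Q'
run-nil e = tt , e

run-++ : ∀ {n} (xs ys : List (Fin n)) {Q Q' Q'' : IceQuiver n} →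
  GreenRun Q xs Q' → GreenRun Q' ys Q'' → GreenRun Q (xs ++ ys) Q''
run-++ xs ys {Q} (g₁ , e₁) (g₂ , e₂) =
  GreenFrom-++ xs ys g₁ (GreenFrom-cong ys (≈Q-sym e₁) g₂) ,
  λ x y → trans (cong (λ R → R x y) (mutateSeq-++ xs ys Q))
                (≈Q-trans (mutateSeq-cong ys e₁) e₂ x y)

run-from : ∀ {n} (s : List (Fin n)) {Q Q' Q'' : IceQuiver n} →
  Q ≈Q Q' → GreenRun Q' s Q'' → GreenRun Q s Q''
run-from s e (g , e₂) = GreenFrom-cong s (≈Q-sym e) g , ≈Q-trans (mutateSeq-cong s e) e₂

data Offset : Set where
  farBelow justBelow atPivot justAbove farAbove : Offset

offset : ℕ → ℕ → Offset
offset (suc i)       (suc k)       = offset i k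
offset zero          zero          = atPivot
offset zero          (suc zero)    = justBelow
offset zero          (suc (suc _)) = farBelow
offset (suc zero)    zero          = justAbove
offset (suc (suc _)) zero          = farAbove

data Class : Set where
  c0 c1 c2 c3 c4+ : Class

classOf : ℕ → Class
classOf 0                         = c0
classOf 1                         = c1
classOf 2                         = c2
classOf 3                         = c3
classOf (suc (suc (suc (suc _)))) = c4+

data Position : Set where
  same succ pred apart : Position

position : ℕ → ℕ → Position
position (suc i)       (suc j)       = position i j
position zero          zero          = same
position (suc zero)    zero          = succ
position zero          (suc zero)    = pred
position zero          (suc (suc _)) = apart
position (suc (suc _)) zero          = apart

swapPosition : Position → Position
swapPosition succ = pred
swapPosition pred = succ
swapPosition r    = r

positionOf : Offset → Position
positionOf atPivot   = same
positionOf justAbove = succ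
positionOf justBelow = pred
positionOf _         = apart

isBelow isAbove isAt isJustBelow isJustAbove isFarAbove : Offset → Bool
isBelow farBelow  = true
isBelow justBelow = true
isBelow _         = false
isAbove justAbove = true
isAbove farAbove  = true
isAbove _         = false
isAt atPivot = true
isAt _       = false
isJustBelow justBelow = true
isJustBelow _         = false
isJustAbove justAbove = true
isJustAbove _         = false
isFarAbove farAbove = true
isFarAbove _        = false

isAtOrAbove isAtOrBelow : Offset → Bool
isAtOrAbove o = isAt o ∨ isAbove o
isAtOrBelow o = isBelow o ∨ isAt o

is0 is1 is2 atLeast1 atLeast2 atLeast3 : Class → Bool
is0 c0 = true
is0 _  = false
is1 c1 = true
is1 _  = false
is2 c2 = true
is2 _  = false
atLeast1 c0 = false
atLeast1 _  = true
atLeast2 c0 = false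
atLeast2 c1 = false
atLeast2 _  = true
atLeast3 c3  = true
atLeast3 c4+ = true
atLeast3 _   = false

isSame isSucc : Position → Bool
isSame same = true
isSame _    = false
isSucc succ = true
isSucc _    = false

-- Not every combination of abstract data comes from actual indices.  The
-- following Boolean relations capture the constraints that the finite check
-- needs, and each is proved to hold for all actual indices.

sameOffset : Offset → Offset → Bool
sameOffset farBelow  farBelow  = true
sameOffset justBelow justBelow = true
sameOffset atPivot   atPivot   = true
sameOffset justAbove justAbove = true
sameOffset farAbove  farAbove  = true
sameOffset _         _         = false

-- `offsetSucc o o'`: o can be the offset of i + 1 when o' is that of i
-- (equivalently: of i relative to k when o' is relative to k + 1).
offsetSucc : Offset → Offset → Bool
offsetSucc farBelow  farBelow  = true
offsetSucc justBelow farBelow  = true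
offsetSucc atPivot   justBelow = true
offsetSucc justAbove atPivot   = true
offsetSucc farAbove  justAbove = true
offsetSucc farAbove  farAbove  = true
offsetSucc _         _         = false

-- Both offsets are exact and differ by at most one.
offsetsNear : Offset → Offset → Bool
offsetsNear justBelow justBelow = true
offsetsNear justBelow atPivot   = true
offsetsNear atPivot   justBelow = true
offsetsNear atPivot   atPivot   = true
offsetsNear atPivot   justAbove = true
offsetsNear justAbove atPivot   = true
offsetsNear justAbove justAbove = true
offsetsNear _         _         = false

offsetsCompatible : Offset → Offset → Position → Bool
offsetsCompatible o o' same  = sameOffset o o'
offsetsCompatible o o' succ  = offsetSucc o o'
offsetsCompatible o o' pred  = offsetSucc o' o
offsetsCompatible o o' apart = not (offsetsNear o o')

sameClass : Class → Class → Bool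
sameClass c0  c0  = true
sameClass c1  c1  = true
sameClass c2  c2  = true
sameClass c3  c3  = true
sameClass c4+ c4+ = true
sameClass _   _   = false

classSucc : Class → Class → Bool
classSucc c1  c0  = true
classSucc c2  c1  = true
classSucc c3  c2  = true
classSucc c4+ c3  = true
classSucc c4+ c4+ = true
classSucc _   _   = false

-- Both classes are exact and differ by at most one.
classesNear : Class → Class → Bool
classesNear c0 c0 = true
classesNear c0 c1 = true
classesNear c1 c0 = true
classesNear c1 c1 = true
classesNear c1 c2 = true
classesNear c2 c1 = true
classesNear c2 c2 = true
classesNear c2 c3 = true
classesNear c3 c2 = true
classesNear c3 c3 = true
classesNear _  _  = false

classesCompatible : Class → Class → Position → Bool
classesCompatible c c' same  = sameClass c c'
classesCompatible c c' succ  = classSucc c c'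
classesCompatible c c' pred  = classSucc c' c
classesCompatible c c' apart = not (classesNear c c')

-- Strict order of classes (c4+ is not below itself).
classLess : Class → Class → Bool
classLess c0 c0 = false
classLess c0 _  = true
classLess c1 c0 = false
classLess c1 c1 = false
classLess c1 _  = true
classLess c2 c3  = true
classLess c2 c4+ = true
classLess c2 _   = false
classLess c3 c4+ = true
classLess c3 _   = false
classLess c4+ _  = false

orderCompatible : Class → Class → Offset → Bool
orderCompatible c4+ c4+ o = true
orderCompatible c   c'  o =
  if classLess c c' then isBelow o else if classLess c' c then isAbove o else isAt o

offset-self : ∀ k → offset k k ≡ atPivot
offset-self zero    = refl
offset-self (suc k) = offset-self k

offset-justBelow : ∀ k → offset k (suc k) ≡ justBelow
offset-justBelow zero    = refl
offset-justBelow (suc k) = offset-justBelow k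

offset-justAbove : ∀ k → offset (suc k) k ≡ justAbove
offset-justAbove zero    = refl
offset-justAbove (suc k) = offset-justAbove k

offset-atPivot : ∀ i k → offset i k ≡ atPivot → i ≡ k
offset-atPivot zero          zero          _ = refl
offset-atPivot zero          (suc zero)    ()
offset-atPivot zero          (suc (suc _)) ()
offset-atPivot (suc zero)    zero          ()
offset-atPivot (suc (suc _)) zero          ()
offset-atPivot (suc i)       (suc k)       e = cong suc (offset-atPivot i k e)

offset-notAtPivot : ∀ i k → ¬ i ≡ k → isAt (offset i k) ≡ false
offset-notAtPivot i k i≢k with offset i k in eq
... | farBelow  = refl
... | justBelow = refl
... | atPivot   = ⊥-elim (i≢k (offset-atPivot i k eq))
... | justAbove = refl
... | farAbove  = refl

offset-below : ∀ i k → suc i ≤ k → isBelow (offset i k) ≡ true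
offset-below zero    (suc zero)    _         = refl
offset-below zero    (suc (suc k)) _         = refl
offset-below (suc i) (suc k)       (s≤s i<k) = offset-below i k i<k

offset-notJustAbove : ∀ i k → i ≤ k → isJustAbove (offset i k) ≡ false
offset-notJustAbove zero    zero          _         = refl
offset-notJustAbove zero    (suc zero)    _         = refl
offset-notJustAbove zero    (suc (suc k)) _         = refl
offset-notJustAbove (suc i) (suc k)       (s≤s i≤k) = offset-notJustAbove i k i≤k

offset-pivotSucc : ∀ i k → T (offsetSucc (offset i k) (offset i (suc k)))
offset-pivotSucc zero                zero          = tt
offset-pivotSucc zero                (suc zero)    = tt
offset-pivotSucc zero                (suc (suc k)) = tt
offset-pivotSucc (suc zero)          zero          = tt
offset-pivotSucc (suc (suc zero))    zero          = tt
offset-pivotSucc (suc (suc (suc i))) zero          = tt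
offset-pivotSucc (suc i)             (suc k)       = offset-pivotSucc i k

position-self : ∀ i → position i i ≡ same
position-self zero    = refl
position-self (suc i) = position-self i

position-same : ∀ i j → position i j ≡ same → i ≡ j
position-same zero          zero          _ = refl
position-same zero          (suc zero)    ()
position-same zero          (suc (suc _)) ()
position-same (suc zero)    zero          ()
position-same (suc (suc _)) zero          ()
position-same (suc i)       (suc j)       e = cong suc (position-same i j e)

position-notSame : ∀ i j → ¬ i ≡ j → isSame (position i j) ≡ false
position-notSame i j i≢j with position i j in eq
... | same  = ⊥-elim (i≢j (position-same i j eq))
... | succ  = refl
... | pred  = refl
... | apart = refl

position-viaOffset : ∀ i k → position i k ≡ positionOf (offset i k)
position-viaOffset zero          zero          = refl
position-viaOffset zero          (suc zero)    = refl
position-viaOffset zero          (suc (suc k)) = refl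
position-viaOffset (suc zero)    zero          = refl
position-viaOffset (suc (suc i)) zero          = refl
position-viaOffset (suc i)       (suc k)       = position-viaOffset i k

position-swap : ∀ i j → position j i ≡ swapPosition (position i j)
position-swap zero          zero          = refl
position-swap zero          (suc zero)    = refl
position-swap zero          (suc (suc j)) = refl
position-swap (suc zero)    zero          = refl
position-swap (suc (suc i)) zero          = refl
position-swap (suc i)       (suc j)       = position-swap i j

offsetsCompatible-farAbove : ∀ r → T (offsetsCompatible farAbove farAbove r)
offsetsCompatible-farAbove same  = tt
offsetsCompatible-farAbove succ  = tt
offsetsCompatible-farAbove pred  = tt
offsetsCompatible-farAbove apart = tt

offsetsCompatible-apartBelow : ∀ o → T (offsetsCompatible o farBelow apart)
offsetsCompatible-apartBelow farBelow  = tt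
offsetsCompatible-apartBelow justBelow = tt
offsetsCompatible-apartBelow atPivot   = tt
offsetsCompatible-apartBelow justAbove = tt
offsetsCompatible-apartBelow farAbove  = tt

offsets-compatible : ∀ i j k → T (offsetsCompatible (offset i k) (offset j k) (position i j))
offsets-compatible (suc i) (suc j) (suc k) = offsets-compatible i j k
offsets-compatible zero                zero                zero = tt
offsets-compatible zero                (suc zero)          zero = tt
offsets-compatible zero                (suc (suc j))       zero = tt
offsets-compatible (suc zero)          zero                zero = tt
offsets-compatible (suc (suc i))       zero                zero = tt
offsets-compatible (suc zero)          (suc zero)          zero = tt
offsets-compatible (suc zero)          (suc (suc zero))    zero = tt
offsets-compatible (suc zero)          (suc (suc (suc j))) zero = tt
offsets-compatible (suc (suc zero))    (suc zero)          zero = tt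
offsets-compatible (suc (suc (suc i))) (suc zero)          zero = tt
offsets-compatible (suc (suc i))       (suc (suc j))       zero =
  offsetsCompatible-farAbove (position i j)
offsets-compatible zero zero (suc zero)    = tt
offsets-compatible zero zero (suc (suc k)) = tt
offsets-compatible zero                (suc zero)          (suc zero)          = tt
offsets-compatible zero                (suc zero)          (suc (suc zero))    = tt
offsets-compatible zero                (suc zero)          (suc (suc (suc k))) = tt
offsets-compatible zero                (suc (suc zero))    (suc zero)          = tt
offsets-compatible zero                (suc (suc (suc j))) (suc zero)          = tt
offsets-compatible zero                (suc (suc j))       (suc (suc k))       = tt
offsets-compatible (suc zero)          zero                (suc zero)          = tt
offsets-compatible (suc zero)          zero                (suc (suc zero))    = tt
offsets-compatible (suc zero)          zero                (suc (suc (suc k))) = tt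
offsets-compatible (suc (suc zero))    zero                (suc zero)          = tt
offsets-compatible (suc (suc (suc i))) zero                (suc zero)          = tt
offsets-compatible (suc (suc i))       zero                (suc (suc k))       =
  offsetsCompatible-apartBelow (offset (suc i) (suc k))

classesCompatible-c4+ : ∀ r → T (classesCompatible c4+ c4+ r)
classesCompatible-c4+ same  = tt
classesCompatible-c4+ succ  = tt
classesCompatible-c4+ pred  = tt
classesCompatible-c4+ apart = tt

classes-compatible : ∀ i j → T (classesCompatible (classOf i) (classOf j) (position i j))
classes-compatible (suc (suc (suc (suc i)))) (suc (suc (suc (suc j)))) =
  classesCompatible-c4+ (position i j)
classes-compatible 0 0 = tt
classes-compatible 0 1 = tt
classes-compatible 0 2 = tt
classes-compatible 0 3 = tt
classes-compatible 0 (suc (suc (suc (suc j)))) = tt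
classes-compatible 1 0 = tt
classes-compatible 1 1 = tt
classes-compatible 1 2 = tt
classes-compatible 1 3 = tt
classes-compatible 1 (suc (suc (suc (suc j)))) = tt
classes-compatible 2 0 = tt
classes-compatible 2 1 = tt
classes-compatible 2 2 = tt
classes-compatible 2 3 = tt
classes-compatible 2 (suc (suc (suc (suc j)))) = tt
classes-compatible 3 0 = tt
classes-compatible 3 1 = tt
classes-compatible 3 2 = tt
classes-compatible 3 3 = tt
classes-compatible 3 4 = tt
classes-compatible 3 (suc (suc (suc (suc (suc j))))) = tt
classes-compatible (suc (suc (suc (suc i)))) 0 = tt
classes-compatible (suc (suc (suc (suc i)))) 1 = tt
classes-compatible (suc (suc (suc (suc i)))) 2 = tt
classes-compatible 4 3 = tt
classes-compatible (suc (suc (suc (suc (suc i))))) 3 = tt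

order-compatible : ∀ i k → T (orderCompatible (classOf i) (classOf k) (offset i k))
order-compatible (suc (suc (suc (suc i)))) (suc (suc (suc (suc k)))) = tt
order-compatible 0 0 = tt
order-compatible 0 1 = tt
order-compatible 0 2 = tt
order-compatible 0 3 = tt
order-compatible 0 (suc (suc (suc (suc k)))) = tt
order-compatible 1 0 = tt
order-compatible 1 1 = tt
order-compatible 1 2 = tt
order-compatible 1 3 = tt
order-compatible 1 (suc (suc (suc (suc k)))) = tt
order-compatible 2 0 = tt
order-compatible 2 1 = tt
order-compatible 2 2 = tt
order-compatible 2 3 = tt
order-compatible 2 (suc (suc (suc (suc k)))) = tt
order-compatible 3 0 = tt
order-compatible 3 1 = tt
order-compatible 3 2 = tt
order-compatible 3 3 = tt
order-compatible 3 4 = tt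
order-compatible 3 (suc (suc (suc (suc (suc k))))) = tt
order-compatible (suc (suc (suc (suc i)))) 0 = tt
order-compatible (suc (suc (suc (suc i)))) 1 = tt
order-compatible (suc (suc (suc (suc i)))) 2 = tt
order-compatible 4 3 = tt
order-compatible (suc (suc (suc (suc (suc i))))) 3 = tt

-- The number of arrows x → y as a function of: x frozen?, class and offset
-- of x, y frozen?, class and offset of y, position of x relative to y.
AbstractQuiver : Set
AbstractQuiver = Bool → Class → Offset → Bool → Class → Offset → Position → ℕ

count : Bool → ℕ
count true  = 1
count false = 0

-- In the descriptions, i, j are the indices of x, y and k is the pivot;
-- m_i is mutable, f_i frozen.  Indices are 0-based: m_i is f_{i+1} of the
-- paper, so the cycle has arrows m_i → m_{i-1} and m_0 → m_{n-1}.

-- Descending stage with pivot k ≥ 3 (for k = n: the framed cycle itself):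
-- m_i → m_{i-1} for 1 ≤ i < k and for i > k, m_0 → m_{k-1}, m_{k-1} → m_k,
-- m_k → m_0; m_i → f_i for i < k, m_0 → f_j for j ≥ k; f_j → m_j for j ≥ k.
descentStage : AbstractQuiver
descentStage false ci oi false cj oj r = count
  ((isSucc r ∧ atLeast1 ci ∧ isBelow oi) ∨ (is0 ci ∧ isJustBelow oj) ∨ (isJustBelow oi ∧ isAt oj)
   ∨ (isAt oi ∧ is0 cj) ∨ (isSucc r ∧ isAbove oi))
descentStage false ci oi true  cj oj r = count ((isSame r ∧ isBelow oi) ∨ (is0 ci ∧ isAtOrAbove oj))
descentStage true  ci oi false cj oj r = count (isSame r ∧ isAtOrAbove oi)
descentStage true  ci oi true  cj oj r = 0

-- After mutating m_2: m_1 → m_2, m_2 → m_0, m_i → m_{i-1} for i ≥ 3;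
-- m_0 → f_0, m_1 → f_1, m_0 → f_j for j ≥ 2; f_j → m_j for j ≥ 2.
stage2 : AbstractQuiver
stage2 false ci oi false cj oj r = count ((is1 ci ∧ is2 cj) ∨ (is2 ci ∧ is0 cj) ∨ (isSucc r ∧ atLeast3 ci))
stage2 false ci oi true  cj oj r = count ((is1 ci ∧ is1 cj) ∨ (is0 ci ∧ is0 cj) ∨ (is0 ci ∧ atLeast2 cj))
stage2 true  ci oi false cj oj r = count (isSame r ∧ atLeast2 ci)
stage2 true  ci oi true  cj oj r = 0

-- After mutating m_1: m_2 → m_0, m_2 → m_1, m_i → m_{i-1} for i ≥ 3;
-- m_0 → f_0, m_0 → f_j for j ≥ 2; f_j → m_j for j ≥ 1.
stage1 : AbstractQuiver
stage1 false ci oi false cj oj r = count ((is2 ci ∧ is0 cj) ∨ (is2 ci ∧ is1 cj) ∨ (isSucc r ∧ atLeast3 ci))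
stage1 false ci oi true  cj oj r = count ((is0 ci ∧ is0 cj) ∨ (is0 ci ∧ atLeast2 cj))
stage1 true  ci oi false cj oj r = count (isSame r ∧ atLeast1 ci)
stage1 true  ci oi true  cj oj r = 0

-- After mutating m_0: m_0 → m_2, m_2 → m_1, m_i → m_{i-1} for i ≥ 3;
-- m_2 → f_0, m_2 → f_j for j ≥ 3; f_0 → m_0, f_1 → m_1, f_j → m_0 for j ≥ 2,
-- f_j → m_j for j ≥ 3.
stage0 : AbstractQuiver
stage0 false ci oi false cj oj r = count ((is0 ci ∧ is2 cj) ∨ (is2 ci ∧ is1 cj) ∨ (isSucc r ∧ atLeast3 ci))
stage0 false ci oi true  cj oj r = count ((is2 ci ∧ is0 cj) ∨ (is2 ci ∧ atLeast3 cj))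
stage0 true  ci oi false cj oj r = count
  ((is0 ci ∧ is0 cj) ∨ (is1 ci ∧ is1 cj) ∨ (atLeast2 ci ∧ is0 cj) ∨ (isSame r ∧ atLeast3 ci))
stage0 true  ci oi true  cj oj r = 0

-- Ascending stage with pivot k ≥ 2: m_0 → m_1, m_1 → m_k, m_2 → m_0,
-- m_i → m_{i-1} for 3 ≤ i ≤ k and for i ≥ k + 2, m_k → m_{k+1}, m_{k+1} → m_1;
-- m_{k+1} → f_0, m_{k+1} → f_j for j ≥ k + 2; f_0 → m_k, f_1 → m_1, f_2 → m_0,
-- f_i → m_{i-1} for 3 ≤ i ≤ k, f_i → m_k for i > k, f_i → m_i for i ≥ k + 2.
-- For k = n - 1 no arrow leaves a mutable vertex towards a frozen one.
ascentStage : AbstractQuiver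
ascentStage false ci oi false cj oj r = count
  ((is0 ci ∧ is1 cj) ∨ (is1 ci ∧ isAt oj) ∨ (is2 ci ∧ is0 cj) ∨ (isSucc r ∧ atLeast3 ci ∧ isAtOrBelow oi)
   ∨ (isAt oi ∧ isJustAbove oj) ∨ (isJustAbove oi ∧ is1 cj) ∨ (isSucc r ∧ isFarAbove oi))
ascentStage true  ci oi false cj oj r = count
  ((is0 ci ∧ isAt oj) ∨ (is1 ci ∧ is1 cj) ∨ (is2 ci ∧ is0 cj) ∨ (isSucc r ∧ atLeast3 ci ∧ isAtOrBelow oi)
   ∨ (isAbove oi ∧ isAt oj) ∨ (isSame r ∧ isFarAbove oi))
ascentStage false ci oi true  cj oj r = count ((isJustAbove oi ∧ is0 cj) ∨ (isJustAbove oi ∧ isFarAbove oj))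
ascentStage true  ci oi true  cj oj r = 0

-- A step mutates at a new pivot k' the quiver described with respect to an old
-- pivot k.  An abstract vertex records the data of a concrete vertex relative
-- to both pivots.

data AbstractVertex : Set where
  vertex : (isFrozen : Bool) → Class → (oldOffset newOffset : Offset) → AbstractVertex

isFrozenA : AbstractVertex → Bool
isFrozenA (vertex t _ _ _) = t

atOld atNew : AbstractQuiver → AbstractVertex → AbstractVertex → Position → ℕ
atOld S (vertex t c o _) (vertex t' c' o' _) r = S t c o t' c' o' r
atNew S (vertex t c _ o) (vertex t' c' _ o') r = S t c o t' c' o' r

isNewPivot : AbstractVertex → Bool
isNewPivot (vertex t _ _ o) = not t ∧ isAt o

positionToNew : AbstractVertex → Position
positionToNew (vertex _ _ _ o) = positionOf o

abstractMutation : AbstractQuiver → AbstractVertex → AbstractVertex → AbstractVertex → Position → ℕ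
abstractMutation S K x y r =
  mutationRule (isFrozenA x ∧ isFrozenA y) (isNewPivot x) (isNewPivot y)
    (atOld S x y r) (atOld S y x (swapPosition r))
    (atOld S x K (positionToNew x)) (atOld S K y (swapPosition (positionToNew y)))
    (atOld S y K (positionToNew y)) (atOld S K x (swapPosition (positionToNew x)))

verticesCompatible : AbstractVertex → AbstractVertex → Position → Bool
verticesCompatible (vertex _ c o₁ o₂) (vertex _ c' o₁' o₂') r =
  classesCompatible c c' r ∧ offsetsCompatible o₁ o₁' r ∧ offsetsCompatible o₂ o₂' r

data PivotMove : Set where
  down up jump : PivotMove

movedOffsets : PivotMove → Offset → Offset → Bool
movedOffsets down oldO newO = offsetSucc newO oldO
movedOffsets up   oldO newO = offsetSucc oldO newO
movedOffsets jump oldO newO = true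

record Step : Set where
  constructor step
  field
    newClass oldClass : Class
    newToOld oldToNew : Offset
    move              : PivotMove
open Step

newPivotA oldPivotA : Step → AbstractVertex
newPivotA p = vertex false (newClass p) (newToOld p) atPivot
oldPivotA p = vertex false (oldClass p) atPivot (oldToNew p)

-- The constraints every abstract vertex arising from an index satisfies.
admissible : Step → AbstractVertex → Bool
admissible p x@(vertex t c oldO newO) =
  verticesCompatible x (oldPivotA p) (positionOf oldO) ∧ verticesCompatible x (newPivotA p) (positionOf newO)
  ∧ orderCompatible c (oldClass p) oldO ∧ orderCompatible c (newClass p) newO ∧ movedOffsets (move p) oldO newO

_⇒_ : Bool → Bool → Bool
true  ⇒ b = b
false ⇒ b = true

record Enumeration (A : Set) : Set where
  field
    elements : List A
    complete : ∀ x → x ∈ elements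
open Enumeration

forAll : ∀ {A} → Enumeration A → (A → Bool) → Bool
forAll E f = all f (elements E)

forAll-sound : ∀ {A} (E : Enumeration A) (f : A → Bool) → T (forAll E f) → ∀ x → T (f x)
forAll-sound E f p x = All.lookup (all⁺ f (elements E) p) (complete E x)

bools : Enumeration Bool
bools = record { elements = true ∷ false ∷ [] ; complete = λ { true → here refl ; false → there (here refl) } }

classes : Enumeration Class
classes = record
  { elements = c0 ∷ c1 ∷ c2 ∷ c3 ∷ c4+ ∷ []
  ; complete = λ { c0 → here refl ; c1 → there (here refl) ; c2 → there (there (here refl))
                 ; c3 → there (there (there (here refl))) ; c4+ → there (there (there (there (here refl)))) }
  }

offsets : Enumeration Offset
offsets = record
  { elements = farBelow ∷ justBelow ∷ atPivot ∷ justAbove ∷ farAbove ∷ []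
  ; complete = λ { farBelow → here refl ; justBelow → there (here refl) ; atPivot → there (there (here refl))
                 ; justAbove → there (there (there (here refl)))
                 ; farAbove → there (there (there (there (here refl)))) }
  }

positions : Enumeration Position
positions = record
  { elements = same ∷ succ ∷ pred ∷ apart ∷ []
  ; complete = λ { same → here refl ; succ → there (here refl) ; pred → there (there (here refl))
                 ; apart → there (there (there (here refl))) }
  }

forAllVertices : (AbstractVertex → Bool) → Bool
forAllVertices f =
  forAll bools λ t → forAll classes λ c → forAll offsets λ o₁ → forAll offsets λ o₂ → f (vertex t c o₁ o₂)

forAllVertices-sound : ∀ f → T (forAllVertices f) → ∀ x → T (f x)
forAllVertices-sound f p (vertex t c o₁ o₂) =
  forAll-sound offsets (λ o₂ → f (vertex t c o₁ o₂))
    (forAll-sound offsets (λ o₁ → forAll offsets λ o₂ → f (vertex t c o₁ o₂))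
      (forAll-sound classes (λ c → forAll offsets λ o₁ → forAll offsets λ o₂ → f (vertex t c o₁ o₂))
        (forAll-sound bools (λ t → forAll classes λ c → forAll offsets λ o₁ → forAll offsets λ o₂ → f (vertex t c o₁ o₂))
          p t) c) o₁) o₂

greenAt : AbstractQuiver → Step → AbstractVertex → Bool
greenAt S p x = not (isFrozenA x) ∨ (atOld S x (newPivotA p) (positionToNew x) ≡ᵇ 0)

mutatesTo : AbstractQuiver → AbstractQuiver → Step → AbstractVertex → AbstractVertex → Position → Bool
mutatesTo S S' p x y r = verticesCompatible x y r ⇒ (abstractMutation S (newPivotA p) x y r ≡ᵇ atNew S' x y r)

checkPair : AbstractQuiver → AbstractQuiver → Step → AbstractVertex → AbstractVertex → Bool
checkPair S S' p x y = admissible p y ⇒ forAll positions (mutatesTo S S' p x y)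

checkVertex : AbstractQuiver → AbstractQuiver → Step → AbstractVertex → Bool
checkVertex S S' p x = admissible p x ⇒ (greenAt S p x ∧ forAllVertices (checkPair S S' p x))

-- The finite check of a step from stage S to stage S'.  It is opaque so that
-- it is evaluated only where a concrete instance is decided.
opaque
  stepCheck : AbstractQuiver → AbstractQuiver → Step → Bool
  stepCheck S S' p = forAllVertices (checkVertex S S' p)

  stepCheck-unfold : ∀ S S' p → T (stepCheck S S' p) → T (forAllVertices (checkVertex S S' p))
  stepCheck-unfold S S' p c = c

opaque
  unfolding stepCheck
  -- Descending: pivot k + 1 → k for k ≥ 4 (both of class ≥4), and 4 → 3.
  check-descent : T (stepCheck descentStage descentStage (step c4+ c4+ justBelow justAbove down))
  check-descent = tt
  check-descent3 : T (stepCheck descentStage descentStage (step c3 c4+ justBelow justAbove down))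
  check-descent3 = tt
  -- Turning: 3 → 2, 2 → 1, 1 → 0, then 0 → 2.
  check-mutate2 : T (stepCheck descentStage stage2 (step c2 c3 justBelow justAbove down))
  check-mutate2 = tt
  check-mutate1 : T (stepCheck stage2 stage1 (step c1 c2 justBelow justAbove down))
  check-mutate1 = tt
  check-mutate0 : T (stepCheck stage1 stage0 (step c0 c1 justBelow justAbove down))
  check-mutate0 = tt
  check-remutate2 : T (stepCheck stage0 ascentStage (step c2 c0 farAbove farBelow jump))
  check-remutate2 = tt
  -- Ascending: pivot 2 → 3, 3 → 4, and k → k + 1 for k ≥ 4.
  check-ascent3 : T (stepCheck ascentStage ascentStage (step c3 c2 justAbove justBelow up))
  check-ascent3 = tt
  check-ascent4 : T (stepCheck ascentStage ascentStage (step c4+ c3 justAbove justBelow up))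
  check-ascent4 = tt
  check-ascent : T (stepCheck ascentStage ascentStage (step c4+ c4+ justAbove justBelow up))
  check-ascent = tt

both : ∀ {a b} → T a → T b → T (a ∧ b)
both ta tb = Equivalence.from T-∧ (ta , tb)

unlessFalse : ∀ {a b} → T (not a ∨ b) → a ≡ true → T b
unlessFalse p refl = p

⇒-elim : ∀ {a b} → T (a ⇒ b) → T a → T b
⇒-elim {true} p _ = p

module _ (S S' : AbstractQuiver) (p : Step) (check : T (stepCheck S S' p))
         (x : AbstractVertex) (admissible-x : T (admissible p x)) where

  private
    checkAt-x : T (greenAt S p x) × T (forAllVertices (checkPair S S' p x))
    checkAt-x = Equivalence.to T-∧
      (⇒-elim (forAllVertices-sound (checkVertex S S' p) (stepCheck-unfold S S' p check) x) admissible-x)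

  check-green : isFrozenA x ≡ true → atOld S x (newPivotA p) (positionToNew x) ≡ 0
  check-green frozen-x = ≡ᵇ⇒≡ _ _ (unlessFalse (proj₁ checkAt-x) frozen-x)

  check-mutation : ∀ y r → T (admissible p y) → T (verticesCompatible x y r) →
    abstractMutation S (newPivotA p) x y r ≡ atNew S' x y r
  check-mutation y r admissible-y compatible = ≡ᵇ⇒≡ _ _ (⇒-elim {verticesCompatible x y r}
    (forAll-sound positions (mutatesTo S S' p x y)
      (⇒-elim (forAllVertices-sound (checkPair S S' p x) (proj₂ checkAt-x) y) admissible-y) r)
    compatible)

index : ∀ {n} → V n → ℕ
index (inj₁ i) = toℕ i
index (inj₂ i) = toℕ i

realise : ∀ {n} → AbstractQuiver → ℕ → IceQuiver n
realise S k x y =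
  S (frozen x) (classOf (index x)) (offset (index x) k)
    (frozen y) (classOf (index y)) (offset (index y) k) (position (index x) (index y))

indexVertex : Bool → ℕ → ℕ → ℕ → AbstractVertex
indexVertex t k k' i = vertex t (classOf i) (offset i k) (offset i k')

abstractVertex : ∀ {n} → ℕ → ℕ → V n → AbstractVertex
abstractVertex k k' x = indexVertex (frozen x) k k' (index x)

stepOf : ℕ → ℕ → PivotMove → Step
stepOf k k' m = step (classOf k') (classOf k) (offset k' k) (offset k k') m

indexVertices-compatible : ∀ t t' k k' i j →
  T (verticesCompatible (indexVertex t k k' i) (indexVertex t' k k' j) (position i j))
indexVertices-compatible t t' k k' i j =
  both (classes-compatible i j) (both (offsets-compatible i j k) (offsets-compatible i j k'))

indexVertex-admissible : ∀ m k k' → (∀ i → T (movedOffsets m (offset i k) (offset i k'))) →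
  ∀ t i → T (admissible (stepOf k k' m) (indexVertex t k k' i))
indexVertex-admissible m k k' moved t i =
  both toOldPivot (both toNewPivot
    (both (order-compatible i k) (both (order-compatible i k') (moved i))))
  where
  toOldPivot : T (verticesCompatible (indexVertex t k k' i) (oldPivotA (stepOf k k' m)) (positionOf (offset i k)))
  toOldPivot = subst₂
    (λ o r → T (verticesCompatible (indexVertex t k k' i) (vertex false (classOf k) o (offset k k')) r))
    (offset-self k) (position-viaOffset i k) (indexVertices-compatible t false k k' i k)
  toNewPivot : T (verticesCompatible (indexVertex t k k' i) (newPivotA (stepOf k k' m)) (positionOf (offset i k')))
  toNewPivot = subst₂
    (λ o r → T (verticesCompatible (indexVertex t k k' i) (vertex false (classOf k') (offset k' k) o) r))
    (offset-self k') (position-viaOffset i k') (indexVertices-compatible t false k k' i k')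

isVertex-abstract : ∀ {n} (k' : Fin n) k x → isVertex k' x ≡ isNewPivot (abstractVertex k (toℕ k') x)
isVertex-abstract k' k (inj₂ j) = refl
isVertex-abstract k' k (inj₁ i) = decided (i Fin.≟ k')
  where
  decided : (d : Dec (i ≡ k')) → does d ≡ isAt (offset (toℕ i) (toℕ k'))
  decided (yes refl) = sym (cong isAt (offset-self (toℕ k')))
  decided (no i≢k')  = sym (offset-notAtPivot (toℕ i) (toℕ k') (λ e → i≢k' (toℕ-injective e)))

mutation-step : ∀ {n} (S S' : AbstractQuiver) (m : PivotMove) (k : ℕ) (k' : Fin n) →
  (∀ i → T (movedOffsets m (offset i k) (offset i (toℕ k')))) →
  T (stepCheck S S' (stepOf k (toℕ k') m)) →
  Green (realise S k) k' × (mutate k' (realise S k) ≈Q realise S' (toℕ k'))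
mutation-step {n} S S' m k k' moved check = green , mutated
  where
  p = stepOf k (toℕ k') m
  a : V n → AbstractVertex
  a = abstractVertex k (toℕ k')
  admissible-a : ∀ x → T (admissible p (a x))
  admissible-a x = indexVertex-admissible m k (toℕ k') moved (frozen x) (index x)
  pivot-a : a (inj₁ k') ≡ newPivotA p
  pivot-a = cong (vertex false (classOf (toℕ k')) (offset (toℕ k') k)) (offset-self (toℕ k'))
  toPivot : ∀ x → realise S k x (inj₁ k') ≡ atOld S (a x) (newPivotA p) (positionToNew (a x))
  toPivot x = cong₂ (atOld S (a x)) pivot-a (position-viaOffset (index x) (toℕ k'))
  fromPivot : ∀ x → realise S k (inj₁ k') x ≡ atOld S (newPivotA p) (a x) (swapPosition (positionToNew (a x)))
  fromPivot x = cong₂ (λ v r → atOld S v (a x) r) pivot-a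
    (trans (position-swap (index x) (toℕ k')) (cong swapPosition (position-viaOffset (index x) (toℕ k'))))
  green : Green (realise S k) k'
  green j = trans (toPivot (inj₂ j)) (check-green S S' p check (a (inj₂ j)) (admissible-a (inj₂ j)) refl)
  mutated : mutate k' (realise S k) ≈Q realise S' (toℕ k')
  mutated x y = trans (mutate-formula k' (realise S k) x y)
    (trans (mutationRule-cong {f = frozen x ∧ frozen y} {q1 = realise S k x y}
              (isVertex-abstract k' k x) (isVertex-abstract k' k y) refl
              (cong (atOld S (a y) (a x)) (position-swap (index x) (index y)))
              (toPivot x) (fromPivot y) (toPivot y) (fromPivot x))
           (check-mutation S S' p check (a x) (admissible-a x) (a y) (position (index x) (index y))
              (admissible-a y) (indexVertices-compatible (frozen x) (frozen y) k (toℕ k') (index x) (index y))))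

run-step : ∀ {n} (S S' : AbstractQuiver) (m : PivotMove) (k k'ℕ : ℕ) (k' : Fin n) → toℕ k' ≡ k'ℕ →
  (∀ i → T (movedOffsets m (offset i k) (offset i k'ℕ))) → T (stepCheck S S' (stepOf k k'ℕ m)) →
  GreenRun (realise S k) (k' ∷ []) (realise S' k'ℕ)
run-step S S' m k .(toℕ k') k' refl moved check = (proj₁ result , tt) , proj₂ result
  where result = mutation-step S S' m k k' moved check

range : ℕ → ℕ → List ℕ
range s zero    = []
range s (suc c) = s ∷ range (suc s) c

descent-check : ∀ k → T (stepCheck descentStage descentStage (stepOf (4 + k) (3 + k) down))
descent-check zero    = check-descent3
descent-check (suc k) =
  subst₂ (λ o o' → T (stepCheck descentStage descentStage (step c4+ c4+ o o' down)))
    (sym (offset-justBelow k)) (sym (offset-justAbove k)) check-descent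

descent : ∀ {n} k (xs : List (Fin n)) → map toℕ xs ≡ downFrom (3 + k) →
  GreenRun (realise descentStage (3 + k)) xs (realise stage0 0)
descent zero (x₂ ∷ x₁ ∷ x₀ ∷ []) e =
  run-++ (x₂ ∷ []) (x₁ ∷ x₀ ∷ [])
    (run-step descentStage stage2 down 3 2 x₂ (∷-injectiveˡ e) (λ i → offset-pivotSucc i 2) check-mutate2)
    (run-++ (x₁ ∷ []) (x₀ ∷ [])
      (run-step stage2 stage1 down 2 1 x₁ (∷-injectiveˡ (∷-injectiveʳ e)) (λ i → offset-pivotSucc i 1) check-mutate1)
      (run-step stage1 stage0 down 1 0 x₀ (∷-injectiveˡ (∷-injectiveʳ (∷-injectiveʳ e)))
        (λ i → offset-pivotSucc i 0) check-mutate0))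
descent (suc k) (x ∷ xs) e =
  run-++ (x ∷ []) xs
    (run-step descentStage descentStage down (4 + k) (3 + k) x (∷-injectiveˡ e)
      (λ i → offset-pivotSucc i (3 + k)) (descent-check k))
    (descent k xs (∷-injectiveʳ e))

ascent-check : ∀ j → T (stepCheck ascentStage ascentStage (stepOf (2 + j) (3 + j) up))
ascent-check zero          = check-ascent3
ascent-check (suc zero)    = check-ascent4
ascent-check (suc (suc j)) =
  subst₂ (λ o o' → T (stepCheck ascentStage ascentStage (step c4+ c4+ o o' up)))
    (sym (offset-justAbove j)) (sym (offset-justBelow j)) check-ascent

ascent : ∀ {n} c j (xs : List (Fin n)) → map toℕ xs ≡ range (3 + j) c →
  GreenRun (realise ascentStage (2 + j)) xs (realise ascentStage (2 + j + c))
ascent zero j [] e =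
  run-nil (λ x y → cong (λ k → realise ascentStage k x y) (sym (+-identityʳ (2 + j))))
ascent (suc c) j (x ∷ xs) e =
  run-++ (x ∷ []) xs
    (run-step ascentStage ascentStage up (2 + j) (3 + j) x (∷-injectiveˡ e)
      (λ i → offset-pivotSucc i (2 + j)) (ascent-check j))
    (subst (λ k → GreenRun (realise ascentStage (3 + j)) xs (realise ascentStage k))
      (sym (+-suc (2 + j) c)) (ascent c (suc j) xs (∷-injectiveʳ e)))

turn-and-ascend : ∀ {n} c (xs : List (Fin n)) → map toℕ xs ≡ range 2 (suc c) →
  GreenRun (realise stage0 0) xs (realise ascentStage (2 + c))
turn-and-ascend c (x ∷ xs) e =
  run-++ (x ∷ []) xs
    (run-step stage0 ascentStage jump 0 2 x (∷-injectiveˡ e) (λ i → tt) check-remutate2)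
    (ascent c 0 xs (∷-injectiveʳ e))

tabulate-toℕ : ∀ n → tabulate {n = n} toℕ ≡ upTo n
tabulate-toℕ n = helper id n
  where
  helper : (f : ℕ → ℕ) (n : ℕ) → tabulate {n = n} (λ i → f (toℕ i)) ≡ applyUpTo f n
  helper f zero    = refl
  helper f (suc n) = cong (f 0 ∷_) (helper (λ i → f (suc i)) n)

descentOrder : ∀ n → map toℕ (reverse (allFin n)) ≡ downFrom n
descentOrder n = begin
  map toℕ (reverse (allFin n))   ≡⟨ reverse-map toℕ (allFin n) ⟩
  reverse (map toℕ (allFin n))   ≡⟨ cong reverse (map-tabulate {n = n} id toℕ) ⟩
  reverse (tabulate {n = n} toℕ) ≡⟨ cong reverse (tabulate-toℕ n) ⟩
  reverse (upTo n)               ≡⟨ reverse-upTo n ⟩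
  downFrom n                     ∎
  where open ≡-Reasoning

tabulate-range : ∀ {n} s m (g : Fin m → Fin n) → (∀ i → toℕ (g i) ≡ s + toℕ i) →
  map toℕ (tabulate g) ≡ range s m
tabulate-range s zero    g shift = refl
tabulate-range s (suc m) g shift =
  cong₂ _∷_ (trans (shift Fin.zero) (+-identityʳ s))
    (tabulate-range (suc s) m (λ i → g (Fin.suc i)) (λ i → trans (shift (Fin.suc i)) (+-suc s (toℕ i))))

-- drop 2 (allFin (3 + c)) is definitionally tabulate (suc ∘ suc).
ascentOrder : ∀ c → map toℕ (drop 2 (allFin (3 + c))) ≡ range 2 (suc c)
ascentOrder c = tabulate-range 2 (suc c) (λ i → Fin.suc (Fin.suc i)) (λ i → refl)

succ-≡ᵇ : ∀ u v → (u ≡ᵇ v) ≡ isSucc (position (suc u) v)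
succ-≡ᵇ zero          zero                = refl
succ-≡ᵇ (suc u)       zero                = refl
succ-≡ᵇ zero          (suc zero)          = refl
succ-≡ᵇ zero          (suc (suc zero))    = refl
succ-≡ᵇ zero          (suc (suc (suc v))) = refl
succ-≡ᵇ (suc u)       (suc v)             = succ-≡ᵇ u v

atLeast1-suc : ∀ u → atLeast1 (classOf (suc u)) ≡ true
atLeast1-suc zero                = refl
atLeast1-suc (suc zero)          = refl
atLeast1-suc (suc (suc zero))    = refl
atLeast1-suc (suc (suc (suc u))) = refl

cycleSucc : ∀ u v → (u ≡ᵇ suc v) ≡ (isSucc (position u v) ∧ atLeast1 (classOf u))
cycleSucc zero    zero          = refl
cycleSucc zero    (suc zero)    = refl
cycleSucc zero    (suc (suc v)) = refl
cycleSucc (suc u) v rewrite atLeast1-suc u | ∧-identityʳ (isSucc (position (suc u) v)) = succ-≡ᵇ u v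

cycleZero : ∀ u → (u ≡ᵇ 0) ≡ is0 (classOf u)
cycleZero zero                      = refl
cycleZero (suc zero)                = refl
cycleZero (suc (suc zero))          = refl
cycleZero (suc (suc (suc zero)))    = refl
cycleZero (suc (suc (suc (suc u)))) = refl

cycleLast : ∀ v n → suc v ≤ n → (v ≡ᵇ n ∸ 1) ≡ isJustBelow (offset v n)
cycleLast zero    (suc zero)    _         = refl
cycleLast zero    (suc (suc n)) _         = refl
cycleLast (suc v) (suc (suc n)) (s≤s v<n) = cycleLast v (suc n) v<n

below-notAtOrAbove : ∀ o → isBelow o ≡ true → isAtOrAbove o ≡ false
below-notAtOrAbove farBelow  _ = refl
below-notAtOrAbove justBelow _ = refl

-- The Boolean content of `cycleArrow`.
booleanIdentity : ∀ p q r b →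
  (if (p ∧ q) ∨ (r ∧ b) then 1 else 0) ≡ count ((p ∧ q ∧ true) ∨ (r ∧ b) ∨ false ∨ false ∨ (p ∧ false))
booleanIdentity true  true  r     b     = refl
booleanIdentity true  false true  true  = refl
booleanIdentity true  false true  false = refl
booleanIdentity true  false false b     = refl
booleanIdentity false q     true  true  = refl
booleanIdentity false q     true  false = refl
booleanIdentity false q     false b     = refl

cycleArrow : ∀ p q r s (oi oj : Offset) → isBelow oi ≡ true → isBelow oj ≡ true →
  (if (p ∧ q) ∨ (r ∧ isJustBelow oj) then 1 else 0) ≡
  count ((p ∧ q ∧ isBelow oi) ∨ (r ∧ isJustBelow oj) ∨ (isJustBelow oi ∧ isAt oj) ∨ (isAt oi ∧ s)
         ∨ (p ∧ isAbove oi))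
cycleArrow p q r s farBelow  farBelow  _ _ = booleanIdentity p q r false
cycleArrow p q r s farBelow  justBelow _ _ = booleanIdentity p q r true
cycleArrow p q r s justBelow farBelow  _ _ = booleanIdentity p q r false
cycleArrow p q r s justBelow justBelow _ _ = booleanIdentity p q r true

offset-index-below : ∀ {n} (i : Fin n) → isBelow (offset (toℕ i) n) ≡ true
offset-index-below {n} i = offset-below (toℕ i) n (toℕ<n i)

framed-cycle : ∀ n → framed (cycleQuiver n) ≈Q realise descentStage n
framed-cycle n (inj₁ i) (inj₁ j)
  rewrite cycleSucc (toℕ i) (toℕ j) | cycleZero (toℕ i) | cycleLast (toℕ j) n (toℕ<n j) =
  cycleArrow (isSucc (position (toℕ i) (toℕ j))) (atLeast1 (classOf (toℕ i))) (is0 (classOf (toℕ i)))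
    (is0 (classOf (toℕ j))) (offset (toℕ i) n) (offset (toℕ j) n) (offset-index-below i) (offset-index-below j)
framed-cycle n (inj₁ i) (inj₂ j) with i Fin.≟ j
... | yes refl rewrite position-self (toℕ i) | offset-index-below i = refl
... | no i≢j
  rewrite position-notSame (toℕ i) (toℕ j) (λ e → i≢j (toℕ-injective e))
        | below-notAtOrAbove _ (offset-index-below j) | ∧-zeroʳ (is0 (classOf (toℕ i))) = refl
framed-cycle n (inj₂ i) (inj₁ j)
  rewrite below-notAtOrAbove _ (offset-index-below i) | ∧-zeroʳ (isSame (position (toℕ i) (toℕ j))) = refl
framed-cycle n (inj₂ i) (inj₂ j) = refl

ascentStage-red : ∀ {n} m (k j : Fin n) → toℕ k ≤ m → realise ascentStage m (inj₁ k) (inj₂ j) ≡ 0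
ascentStage-red m k j k≤m rewrite offset-notJustAbove (toℕ k) m k≤m = refl

mainTheorem2 : (n : ℕ) → 3 ≤ n → IsMaximalGreenSequence (cycleQuiver n) (cycleSequence n)
mainTheorem2 (suc (suc (suc c))) (s≤s (s≤s (s≤s z≤n))) = green , red
  where
  n = 3 + c
  run : GreenRun (framed (cycleQuiver n)) (cycleSequence n) (realise ascentStage (2 + c))
  run = run-from (cycleSequence n) (framed-cycle n)
    (run-++ (reverse (allFin n)) (drop 2 (allFin n))
      (descent c (reverse (allFin n)) (descentOrder n))
      (turn-and-ascend c (drop 2 (allFin n)) (ascentOrder c)))
  green : IsGreenSequence (cycleQuiver n) (cycleSequence n)
  green = proj₁ run
  red : ∀ k → Red (mutateSeq (cycleSequence n) (framed (cycleQuiver n))) k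
  red k j = trans (proj₂ run (inj₁ k) (inj₂ j)) (ascentStage-red (2 + c) k j (≤-pred (toℕ<n k)))
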